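{- For every positive integer $k$ there exists a constant $c_k>0$ such that $D(n,k)\geq c_k\, n^{\lfloor k/2\rfloor}$ for all sufficiently large $n$; that is, $D(n,k)=\Omega_k(n^{\lfloor k/2\rfloor})$.
   Context: All graphs are finite, simple and undirected. For a graph $G$ and an integer $k\geq 1$, the $k$-configuration graph $\mathcal{R}_k(G)$ (token jumping model) is the graph whose vertices are the independent sets of $G$ of size exactly $k$, where two such independent sets $I,J$ are adjacent if and only if $|I\cap J|=k-1$. $D(n,k)$ denotes the maximum, over all graphs $G$ on $n$ vertices, of the largest diameter of a connected component of $\mathcal{R}_k(G)$. -}

module Defs where

open import Data.Nat using (ℕ; zero; suc; _≤_; _∸_)
open import Data.Bool using (Bool; true; false)
open import Data.Fin using (Fin)
open import Data.Fin.Subset using (Subset; _∈_; _∩_; ∣_∣)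
open import Data.Product using (Σ; ∃; _×_)
open import Relation.Binary.PropositionalEquality using (_≡_)
open import Relation.Nullary using (¬_)

record Graph (n : ℕ) : Set where
  field
    E     : Fin n → Fin n → Bool
    sym   : ∀ x y → E x y ≡ E y x
    irrefl : ∀ x → E x x ≡ false
open Graph public

IndSet : ∀ {n} → Graph n → ℕ → Subset n → Set
IndSet G k I = (∣ I ∣ ≡ k) × (∀ x y → x ∈ I → y ∈ I → E G x y ≡ false)

-- Adjacency in the k-configuration graph R_k(G) (token jumping):
-- both are independent k-sets and |I ∩ J| = k - 1.
RAdj : ∀ {n} → Graph n → ℕ → Subset n → Subset n → Set
RAdj G k I J = IndSet G k I × IndSet G k J × (∣ I ∩ J ∣ ≡ k ∸ 1)

data Walk {n : ℕ} (G : Graph n) (k : ℕ) : Subset n → Subset n → ℕ → Set where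
  here : ∀ {I} → IndSet G k I → Walk G k I I zero
  step : ∀ {I J K m} → RAdj G k I J → Walk G k J K m → Walk G k I K (suc m)

DistAtLeast : ∀ {n} → Graph n → ℕ → Subset n → Subset n → ℕ → Set
DistAtLeast G k I J d =
  IndSet G k I × IndSet G k J
  × (∃ λ m → Walk G k I J m)
  × (∀ m → Walk G k I J m → d ≤ m)

-- "D(n,k) ≥ d": some graph G on n vertices has a connected component of
-- R_k(G) of diameter at least d (the diameter of a component is the
-- maximum distance between two of its vertices; D(n,k) is the maximum of
-- these over all G on n vertices and all components).
D≥ : ℕ → ℕ → ℕ → Set
D≥ n k d = Σ (Graph n) λ G → Σ (Subset n) λ I → Σ (Subset n) λ J → DistAtLeast G k I J d

module Submission where

-- The graphs are built two tokens at a time. A gadget for k tokens is a graph together with a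
-- potential that changes by at most one along edges of R_k and rises by L between two
-- connected vertices of R_k. For k + 2 tokens, place the complement of a path on P ≈ 6J
-- vertices above it: an independent (k + 2)-set is then a pair {p, p + 1} of
-- consecutive path vertices plus an independent k-set below. The path vertices are joined to
-- the gadget in a pattern of period six which forces the lower k-set to go from source to
-- target and back before the pair can advance by six, so the new distance is about 2JL.
-- Starting from the empty graph (k = 0) or a complete graph (k = 1) this yields distance at
-- least (2J)^⌊k/2⌋ on n vertices with J ≈ n / c_k.

open import Defs hiding (sym)
open import Data.Nat
open import Data.Nat.Properties
open import Data.Nat.DivMod
open import Data.Nat.Tactic.RingSolver
open import Data.Bool using (Bool; true; false; _∧_; not)
open import Data.Fin as Fin using (Fin; zero; suc; toℕ; _↑ˡ_; _↑ʳ_; splitAt)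
open import Data.Fin.Properties as Finₚ using (splitAt-↑ˡ; splitAt-↑ʳ)
open import Data.Fin.Subset using (Subset; _∩_; ∣_∣; ⊥; ⁅_⁆)
open import Data.Fin.Subset.Properties
  using ( ∣p∩q∣≤∣p∣; ∣p∩q∣≤∣q∣; x∈p∩q⁻; ∣⊥∣≡0; ∣⁅x⁆∣≡1; x∈⁅y⁆⇒x≡y; Empty-unique; nonempty?
        ; ∩-comm; ∩-idem; ∩-zeroˡ)
open import Data.Vec using (Vec; _∷_; []; _++_; lookup; take; drop)
open import Data.Vec.Properties
  using ( []=⇒lookup; lookup⇒[]=; lookup-replicate; lookup-++ˡ; lookup-++ʳ; lookup-splitAt; zipWith-++
        ; take++drop≡id; ++-injectiveˡ; ++-injectiveʳ)
open import Data.Product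
open import Function using (case_of_; _∘_)
open import Data.Sum using (_⊎_; inj₁; inj₂; [_,_]′)
open import Data.Empty using (⊥-elim)
open import Relation.Binary.PropositionalEquality hiding ([_]; J)
open import Relation.Nullary using (yes; no; does)
open import Relation.Nullary.Decidable using (dec-true; dec-false; True; toWitness)

private variable
  n m : ℕ

∣p++q∣≡∣p∣+∣q∣ : (p : Subset n) (q : Subset m) → ∣ p ++ q ∣ ≡ ∣ p ∣ + ∣ q ∣
∣p++q∣≡∣p∣+∣q∣ []          q = refl
∣p++q∣≡∣p∣+∣q∣ (true ∷ p)  q = cong suc (∣p++q∣≡∣p∣+∣q∣ p q)
∣p++q∣≡∣p∣+∣q∣ (false ∷ p) q = ∣p++q∣≡∣p∣+∣q∣ p q

∣p++q∩r++s∣ : (p r : Subset n) (q s : Subset m) →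
              ∣ (p ++ q) ∩ (r ++ s) ∣ ≡ ∣ p ∩ r ∣ + ∣ q ∩ s ∣
∣p++q∩r++s∣ p r q s = trans (cong ∣_∣ (zipWith-++ _∧_ p q r s)) (∣p++q∣≡∣p∣+∣q∣ (p ∩ r) (q ∩ s))

∣p∩q∣≡∣p∣≡∣q∣⇒p≡q : (p q : Subset n) → ∣ p ∩ q ∣ ≡ ∣ p ∣ → ∣ p ∣ ≡ ∣ q ∣ → p ≡ q
∣p∩q∣≡∣p∣≡∣q∣⇒p≡q []          []          _  _  = refl
∣p∩q∣≡∣p∣≡∣q∣⇒p≡q (true ∷ p)  (true ∷ q)  e₁ e₂ =
  cong (true ∷_) (∣p∩q∣≡∣p∣≡∣q∣⇒p≡q p q (suc-injective e₁) (suc-injective e₂))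
∣p∩q∣≡∣p∣≡∣q∣⇒p≡q (true ∷ p)  (false ∷ q) e₁ _  =
  ⊥-elim (1+n≰n (subst (_≤ ∣ p ∣) e₁ (∣p∩q∣≤∣p∣ p q)))
∣p∩q∣≡∣p∣≡∣q∣⇒p≡q (false ∷ p) (true ∷ q)  e₁ e₂ =
  ⊥-elim (1+n≰n (subst (_≤ ∣ q ∣) (trans e₁ e₂) (∣p∩q∣≤∣q∣ p q)))
∣p∩q∣≡∣p∣≡∣q∣⇒p≡q (false ∷ p) (false ∷ q) e₁ e₂ =
  cong (false ∷_) (∣p∩q∣≡∣p∣≡∣q∣⇒p≡q p q e₁ e₂)

none⇒≡⊥ : (p : Subset n) → (∀ u → lookup p u ≢ true) → p ≡ ⊥
none⇒≡⊥ p none = Empty-unique (λ (u , u∈p) → none u ([]=⇒lookup u∈p))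

none⇒∣p∣≡0 : ∀ {n} (p : Subset n) → (∀ u → lookup p u ≢ true) → ∣ p ∣ ≡ 0
none⇒∣p∣≡0 {n} p none = trans (cong ∣_∣ (none⇒≡⊥ p none)) (∣⊥∣≡0 n)

1≤∣p∣⇒some : ∀ {n} (p : Subset n) → 1 ≤ ∣ p ∣ → ∃ λ u → lookup p u ≡ true
1≤∣p∣⇒some {n} p 1≤∣p∣ with nonempty? p
... | yes (u , u∈p) = u , []=⇒lookup u∈p
... | no  empty     =
  ⊥-elim (1+n≰n (subst (1 ≤_) (trans (cong ∣_∣ (Empty-unique empty)) (∣⊥∣≡0 n)) 1≤∣p∣))

take-++ : ∀ {a} {A : Set a} (xs : Vec A n) (ys : Vec A m) → take n (xs ++ ys) ≡ xs
take-++ {n} xs ys = ++-injectiveˡ (take n (xs ++ ys)) xs (take++drop≡id n (xs ++ ys))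

drop-++ : ∀ {a} {A : Set a} (xs : Vec A n) (ys : Vec A m) → drop n (xs ++ ys) ≡ ys
drop-++ {n} xs ys = ++-injectiveʳ (take n (xs ++ ys)) xs (take++drop≡id n (xs ++ ys))

≤∧≤∧+≡⇒≡ : ∀ {x y a b} → x ≤ a → y ≤ b → x + y ≡ a + b → x ≡ a × y ≡ b
≤∧≤∧+≡⇒≡ {x} {y} {a} {b} x≤a y≤b sum =
  x≡a , +-cancelˡ-≡ a y b (trans (cong (_+ y) (sym x≡a)) sum)
  where
  x≡a : x ≡ a
  x≡a = ≤-antisym x≤a (+-cancelʳ-≤ b a x (≤-trans (≤-reflexive (sym sum)) (+-monoʳ-≤ x y≤b)))

m+n≡1+o∧n≤o⇒1≤m : ∀ {m n o} → m + n ≡ suc o → n ≤ o → 1 ≤ m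
m+n≡1+o∧n≤o⇒1≤m {zero}  sum n≤o = ⊥-elim (1+n≰n (≤-trans (≤-reflexive (sym sum)) n≤o))
m+n≡1+o∧n≤o⇒1≤m {suc m} _   _   = s≤s z≤n

[m*n]^o≡m^o*n^o : ∀ m n o → (m * n) ^ o ≡ m ^ o * n ^ o
[m*n]^o≡m^o*n^o m n zero    = refl
[m*n]^o≡m^o*n^o m n (suc o) = begin
  m * n * (m * n) ^ o         ≡⟨ cong (m * n *_) ([m*n]^o≡m^o*n^o m n o) ⟩
  m * n * (m ^ o * n ^ o)     ≡⟨ interchange m n (m ^ o) (n ^ o) ⟩
  m * m ^ o * (n * n ^ o)     ∎
  where
  open ≡-Reasoning
  interchange : ∀ a b x y → a * b * (x * y) ≡ a * x * (b * y)
  interchange = solve-∀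

quotient-bounds : ∀ M .{{_ : NonZero M}} {n} → M ≤ n →
                  1 ≤ n / M × n / M * M ≤ n × n ≤ M * (2 * (n / M))
quotient-bounds M {n} M≤n = 1≤J , m/n*n≤m n M , (begin
  n               ≡⟨ m≡m%n+[m/n]*n n M ⟩
  n % M + J * M   ≤⟨ +-monoˡ-≤ (J * M) (<⇒≤ (m%n<n n M)) ⟩
  M + J * M       ≡⟨ cong (_+ J * M) (sym (*-identityˡ M)) ⟩
  1 * M + J * M   ≤⟨ +-monoˡ-≤ (J * M) (*-monoˡ-≤ M 1≤J) ⟩
  J * M + J * M   ≡⟨ double M J ⟩
  M * (2 * J)     ∎)
  where
  open ≤-Reasoning
  J = n / M
  1≤J = m≥n⇒m/n>0 M≤n
  double : ∀ M J → J * M + J * M ≡ M * (2 * J)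
  double = solve-∀

-- Unlike IndSet, membership is read off with lookup, which computes on concrete subsets.
Independent : Graph n → Subset n → Set
Independent G s = ∀ x y → lookup s x ≡ true → lookup s y ≡ true → E G x y ≡ false

IndSet⇒Independent : ∀ {G : Graph n} {k s} → IndSet G k s → Independent G s
IndSet⇒Independent (_ , ind) x y x∈s y∈s = ind x y (lookup⇒[]= x _ x∈s) (lookup⇒[]= y _ y∈s)

Independent⇒IndSet : ∀ {G : Graph n} {k s} → ∣ s ∣ ≡ k → Independent G s → IndSet G k s
Independent⇒IndSet size ind = size , λ x y x∈s y∈s → ind x y ([]=⇒lookup x∈s) ([]=⇒lookup y∈s)

IndSet-⁅_⁆ : (G : Graph n) (u : Fin n) → IndSet G 1 ⁅ u ⁆
IndSet-⁅ G ⁆ u = Independent⇒IndSet {G = G} (∣⁅x⁆∣≡1 u) λ x y x∈ y∈ →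
  subst₂ (λ x y → E G x y ≡ false) (sym (∈⁅u⁆ x x∈)) (sym (∈⁅u⁆ y y∈)) (irrefl G u)
  where
  ∈⁅u⁆ : ∀ x → lookup ⁅ u ⁆ x ≡ true → x ≡ u
  ∈⁅u⁆ x x∈ = x∈⁅y⁆⇒x≡y u (lookup⇒[]= x _ x∈)

Avoids : Subset n → (Fin n → Bool) → Set
Avoids s X = ∀ u → lookup s u ≡ true → X u ≡ false

RAdj-sym : (G : Graph n) (k : ℕ) {I J : Subset n} → RAdj G k I J → RAdj G k J I
RAdj-sym G k {I} {J} (I-ind , J-ind , shared) = J-ind , I-ind , trans (cong ∣_∣ (∩-comm J I)) shared

module _ {G : Graph n} {k : ℕ} where

  Walk-source : ∀ {I J m} → Walk G k I J m → IndSet G k I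
  Walk-source (here I-ind)    = I-ind
  Walk-source (step adj _)    = proj₁ adj

  Walk-target : ∀ {I J m} → Walk G k I J m → IndSet G k J
  Walk-target (here I-ind)    = I-ind
  Walk-target (step _ walk)   = Walk-target walk

  Walk-++ : ∀ {I J K m m′} → Walk G k I J m → Walk G k J K m′ → Walk G k I K (m + m′)
  Walk-++ (here _)        walk′ = walk′
  Walk-++ (step adj walk) walk′ = step adj (Walk-++ walk walk′)

  Walk-reverse : ∀ {I J m} → Walk G k I J m → Walk G k J I m
  Walk-reverse (here I-ind) = here I-ind
  Walk-reverse {I} {m = suc m} (step adj walk) =
    subst (Walk G k _ I) (+-comm m 1)
      (Walk-++ (Walk-reverse walk) (step (RAdj-sym G k adj) (here (proj₁ adj))))

  Walk-length≥ : (φ : Subset n → ℕ) → (∀ I J → RAdj G k I J → φ J ≤ suc (φ I)) →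
                 ∀ {I J m} → Walk G k I J m → φ J ≤ φ I + m
  Walk-length≥ φ lipschitz (here _) = m≤m+n _ 0
  Walk-length≥ φ lipschitz {I} {m = suc m} (step {J = J} adj walk) = begin
    _             ≤⟨ Walk-length≥ φ lipschitz walk ⟩
    φ J + m       ≤⟨ +-monoˡ-≤ m (lipschitz I J adj) ⟩
    suc (φ I) + m ≡⟨ sym (+-suc (φ I) m) ⟩
    φ I + suc m   ∎
    where open ≤-Reasoning

-- The pins let a larger graph control the potential: a new vertex adjacent to all of
-- pinSource can only be combined with independent k-sets of potential 0.
record Gadget (k V L : ℕ) : Set where
  field
    graph               : Graph V
    potential           : Subset V → ℕ
    source target       : Subset V
    source-ind          : IndSet graph k source
    target-ind          : IndSet graph k target
    source⇝target       : ∃ λ m → Walk graph k source target m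
    potential-lipschitz : ∀ I J → RAdj graph k I J → potential J ≤ suc (potential I)
    potential-source    : potential source ≡ 0
    potential-target    : potential target ≡ L
    pinSource pinTarget : Fin V → Bool
    pinned-source       : ∀ I → IndSet graph k I → Avoids I pinSource → potential I ≡ 0
    pinned-target       : ∀ I → IndSet graph k I → Avoids I pinTarget → potential I ≡ L
    source-avoids       : Avoids source pinSource
    target-avoids       : Avoids target pinTarget
    independence≤       : ∀ I → Independent graph I → ∣ I ∣ ≤ k

Gadget⇒D≥ : ∀ {k V L} → Gadget k V L → D≥ V k L
Gadget⇒D≥ g = graph , source , target , source-ind , target-ind , source⇝target , far-apart
  where
  open Gadget g
  far-apart : ∀ m → Walk graph _ source target m → _ ≤ m
  far-apart m walk = subst₂ (λ a b → a ≤ b + m) potential-target potential-source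
                       (Walk-length≥ potential potential-lipschitz walk)

emptyGadget : Gadget 0 0 0
emptyGadget = record
  { graph = G₀ ; potential = λ _ → 0 ; source = [] ; target = [] ; source-ind = ind₀ ; target-ind = ind₀
  ; source⇝target = 0 , here ind₀ ; potential-lipschitz = λ _ _ _ → z≤n
  ; potential-source = refl ; potential-target = refl ; pinSource = λ () ; pinTarget = λ ()
  ; pinned-source = λ _ _ _ → refl ; pinned-target = λ _ _ _ → refl
  ; source-avoids = λ () ; target-avoids = λ () ; independence≤ = λ { [] _ → z≤n } }
  where
  G₀ : Graph 0
  G₀ = record { E = λ () ; sym = λ () ; irrefl = λ () }
  ind₀ : IndSet G₀ 0 []
  ind₀ = refl , λ ()

complete : ∀ n → Graph n
complete n = record { E = λ u v → not (does (u Fin.≟ v)) ; sym = E-sym ; irrefl = E-irrefl }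
  where
  E-sym : ∀ u v → not (does (u Fin.≟ v)) ≡ not (does (v Fin.≟ u))
  E-sym u v with u Fin.≟ v
  ... | yes u≡v = cong not (sym (dec-true (v Fin.≟ u) (sym u≡v)))
  ... | no  u≢v = cong not (sym (dec-false (v Fin.≟ u) (λ v≡u → u≢v (sym v≡u))))
  E-irrefl : ∀ u → not (does (u Fin.≟ u)) ≡ false
  E-irrefl u = cong not (dec-true (u Fin.≟ u) refl)

Independent-complete⇒∣s∣≤1 : (s : Subset n) → Independent (complete n) s → ∣ s ∣ ≤ 1
Independent-complete⇒∣s∣≤1 s ind =
  singleton s (λ u v u∈s v∈s → non-adjacent⇒≡ u v (ind u v u∈s v∈s))
  where
  non-adjacent⇒≡ : ∀ {n} (u v : Fin n) → not (does (u Fin.≟ v)) ≡ false → u ≡ v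
  non-adjacent⇒≡ u v _ with u Fin.≟ v
  non-adjacent⇒≡ u v _  | yes u≡v = u≡v
  non-adjacent⇒≡ u v () | no _
  singleton : ∀ {n} (s : Subset n) →
              (∀ u v → lookup s u ≡ true → lookup s v ≡ true → u ≡ v) → ∣ s ∣ ≤ 1
  singleton []          _    = z≤n
  singleton (true ∷ s) same =
    s≤s (≤-reflexive (none⇒∣p∣≡0 s (λ u u∈s → Finₚ.0≢1+n (same zero (suc u) refl u∈s))))
  singleton (false ∷ s) same =
    singleton s (λ u v u∈s v∈s → Finₚ.suc-injective (same (suc u) (suc v) u∈s v∈s))

module CompleteGadget (b : ℕ) where
  K : Graph (2 + b)
  K = complete (2 + b)

  distance-from-0 : Subset (2 + b) → ℕ
  distance-from-0 (true ∷ _)  = 0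
  distance-from-0 (false ∷ _) = 1

  pinSource pinTarget : Fin (2 + b) → Bool
  pinSource zero    = false
  pinSource (suc _) = true
  pinTarget zero    = true
  pinTarget (suc _) = false

  adj-0-1 : RAdj K 1 ⁅ zero ⁆ ⁅ suc zero ⁆
  adj-0-1 = IndSet-⁅ K ⁆ zero , IndSet-⁅ K ⁆ (suc zero) ,
            trans (cong ∣_∣ (∩-zeroˡ (⊥ {b}))) (∣⊥∣≡0 b)

  distance-from-0-lipschitz : ∀ I J → RAdj K 1 I J → distance-from-0 J ≤ suc (distance-from-0 I)
  distance-from-0-lipschitz I (true ∷ _)  _ = z≤n
  distance-from-0-lipschitz I (false ∷ _) _ = s≤s z≤n

  pinned-source : ∀ I → IndSet K 1 I → Avoids I pinSource → distance-from-0 I ≡ 0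
  pinned-source (true ∷ _)  _          _      = refl
  pinned-source (false ∷ I) (size , _) avoids =
    let u , u∈I = 1≤∣p∣⇒some I (≤-reflexive (sym size)) in case avoids (suc u) u∈I of λ ()

  pinned-target : ∀ I → IndSet K 1 I → Avoids I pinTarget → distance-from-0 I ≡ 1
  pinned-target (true ∷ _)  _ avoids = case avoids zero refl of λ ()
  pinned-target (false ∷ _) _ _      = refl

  source-avoids : Avoids ⁅ zero ⁆ pinSource
  source-avoids zero    _ = refl
  source-avoids (suc u) u∈ = case trans (sym u∈) (lookup-replicate u false) of λ ()

  target-avoids : Avoids ⁅ suc zero ⁆ pinTarget
  target-avoids zero       ()
  target-avoids (suc zero) _ = refl
  target-avoids (suc (suc u)) u∈ = case trans (sym u∈) (lookup-replicate u false) of λ ()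

  gadget : Gadget 1 (2 + b) 1
  gadget = record
    { graph = K ; potential = distance-from-0 ; source = ⁅ zero ⁆ ; target = ⁅ suc zero ⁆
    ; source-ind = IndSet-⁅ K ⁆ zero ; target-ind = IndSet-⁅ K ⁆ (suc zero)
    ; source⇝target = 1 , step adj-0-1 (here (IndSet-⁅ K ⁆ (suc zero)))
    ; potential-lipschitz = distance-from-0-lipschitz
    ; potential-source = refl ; potential-target = refl
    ; pinSource = pinSource ; pinTarget = pinTarget
    ; pinned-source = pinned-source ; pinned-target = pinned-target
    ; source-avoids = source-avoids ; target-avoids = target-avoids
    ; independence≤ = Independent-complete⇒∣s∣≤1 }

apart : ℕ → ℕ → Bool
apart zero    b       = 2 ≤ᵇ b
apart (suc a) zero    = 2 ≤ᵇ suc a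
apart (suc a) (suc b) = apart a b

apart-sym : ∀ a b → apart a b ≡ apart b a
apart-sym zero    zero    = refl
apart-sym zero    (suc b) = refl
apart-sym (suc a) zero    = refl
apart-sym (suc a) (suc b) = apart-sym a b

apart-irrefl : ∀ a → apart a a ≡ false
apart-irrefl zero    = refl
apart-irrefl (suc a) = apart-irrefl a

apart-suc : ∀ a → apart a (suc a) ≡ false
apart-suc zero    = refl
apart-suc (suc a) = apart-suc a

-- Independent sets of the complement of the path 0 - 1 - ⋯ - (P-1).
Close : Subset n → Set
Close a = ∀ u v → lookup a u ≡ true → lookup a v ≡ true → apart (toℕ u) (toℕ v) ≡ false

onlyFirst : (P : ℕ) → Subset P
onlyFirst zero    = []
onlyFirst (suc P) = true ∷ ⊥

pair : (P p : ℕ) → Subset P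
pair zero    _       = []
pair (suc P) zero    = true ∷ onlyFirst P
pair (suc P) (suc p) = false ∷ pair P p

firstIndex : Subset n → ℕ
firstIndex []          = 0
firstIndex (true ∷ _)  = 0
firstIndex (false ∷ a) = suc (firstIndex a)

Close-tail : (x : Bool) (a : Subset n) → Close (x ∷ a) → Close a
Close-tail x a close u v u∈ v∈ = close (suc u) (suc v) u∈ v∈

Close-head : (a : Subset n) → Close (true ∷ a) → ∀ u → lookup a u ≡ true → toℕ u ≡ 0
Close-head a close u u∈ with toℕ u | close zero (suc u) refl u∈
... | zero | _ = refl

Close⇒∣a∣≤2 : (a : Subset n) → Close a → ∣ a ∣ ≤ 2
Close⇒∣a∣≤2 []          _     = z≤n
Close⇒∣a∣≤2 (true ∷ a)  close = s≤s (at-most-head a (Close-head a close))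
  where
  at-most-head : ∀ {n} (a : Subset n) → (∀ u → lookup a u ≡ true → toℕ u ≡ 0) → ∣ a ∣ ≤ 1
  at-most-head []          _    = z≤n
  at-most-head (true ∷ a)  head = s≤s (≤-reflexive (none⇒∣p∣≡0 a (λ u u∈ → 1+n≢0 (head (suc u) u∈))))
  at-most-head (false ∷ a) head = ≤-trans (≤-reflexive (none⇒∣p∣≡0 a (λ u u∈ → 1+n≢0 (head (suc u) u∈)))) z≤n
Close⇒∣a∣≤2 (false ∷ a) close = Close⇒∣a∣≤2 a (Close-tail false a close)

Close∧∣a∣≡2⇒pair : (a : Subset n) → Close a → ∣ a ∣ ≡ 2 →
                   a ≡ pair n (firstIndex a) × 2 + firstIndex a ≤ n
Close∧∣a∣≡2⇒pair (false ∷ a) close size =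
  let a≡pair , fits = Close∧∣a∣≡2⇒pair a (Close-tail false a close) size
  in cong (false ∷_) a≡pair , s≤s fits
Close∧∣a∣≡2⇒pair (true ∷ true ∷ a) close _ =
  cong (λ a → true ∷ true ∷ a) (none⇒≡⊥ a (λ u u∈ → 1+n≢0 (Close-head _ close (suc u) u∈))) ,
  s≤s (s≤s z≤n)
Close∧∣a∣≡2⇒pair (true ∷ false ∷ a) close size =
  ⊥-elim (0≢1+n (trans (sym (none⇒∣p∣≡0 a (λ u u∈ → 1+n≢0 (Close-head _ close (suc u) u∈))))
                       (suc-injective size)))

pair-members : ∀ P p (u : Fin P) → lookup (pair P p) u ≡ true → toℕ u ≡ p ⊎ toℕ u ≡ suc p
pair-members (suc zero)    zero    zero          _  = inj₁ refl
pair-members (suc (suc P)) zero    zero          _  = inj₁ refl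
pair-members (suc (suc P)) zero    (suc zero)    _  = inj₂ refl
pair-members (suc (suc P)) zero    (suc (suc u)) u∈ = case trans (sym u∈) (lookup-replicate u false) of λ ()
pair-members (suc P)       (suc p) (suc u)       u∈ with pair-members P p u u∈
... | inj₁ u≡p  = inj₁ (cong suc u≡p)
... | inj₂ u≡p+1 = inj₂ (cong suc u≡p+1)

pair-∋-first : ∀ {P p} → 2 + p ≤ P → ∃ λ u → toℕ u ≡ p × lookup (pair P p) u ≡ true
pair-∋-first {suc (suc P)} {zero}  _          = zero , refl , refl
pair-∋-first {suc P}       {suc p} (s≤s fits) =
  let u , u≡p , u∈ = pair-∋-first fits in suc u , cong suc u≡p , u∈

pair-∋-second : ∀ {P p} → 2 + p ≤ P → ∃ λ u → toℕ u ≡ suc p × lookup (pair P p) u ≡ true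
pair-∋-second {suc (suc P)} {zero}  _          = suc zero , refl , refl
pair-∋-second {suc P}       {suc p} (s≤s fits) =
  let u , u≡p+1 , u∈ = pair-∋-second fits in suc u , cong suc u≡p+1 , u∈

firstIndex-pair : ∀ {P p} → 2 + p ≤ P → firstIndex (pair P p) ≡ p
firstIndex-pair {suc (suc P)} {zero}  _          = refl
firstIndex-pair {suc P}       {suc p} (s≤s fits) = cong suc (firstIndex-pair fits)

∣pair∣≡2 : ∀ {P p} → 2 + p ≤ P → ∣ pair P p ∣ ≡ 2
∣pair∣≡2 {suc (suc P)} {zero}  _          = cong (2 +_) (∣⊥∣≡0 P)
∣pair∣≡2 {suc P}       {suc p} (s≤s fits) = ∣pair∣≡2 fits

∣pair∩pair∣≡2 : ∀ {P p} → 2 + p ≤ P → ∣ pair P p ∩ pair P p ∣ ≡ 2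
∣pair∩pair∣≡2 {P} {p} fits = trans (cong ∣_∣ (∩-idem (pair P p))) (∣pair∣≡2 fits)

pair-Close : ∀ P p → Close (pair P p)
pair-Close P p u v u∈ v∈ with pair-members P p u u∈ | pair-members P p v v∈
... | inj₁ u≡p   | inj₁ v≡p   rewrite u≡p   | v≡p   = apart-irrefl p
... | inj₁ u≡p   | inj₂ v≡p+1 rewrite u≡p   | v≡p+1 = apart-suc p
... | inj₂ u≡p+1 | inj₁ v≡p   rewrite u≡p+1 | v≡p   = trans (apart-sym (suc p) p) (apart-suc p)
... | inj₂ u≡p+1 | inj₂ v≡p+1 rewrite u≡p+1 | v≡p+1 = apart-irrefl (suc p)

pair-meet : ∀ P p q → 1 ≤ ∣ pair P p ∩ pair P q ∣ → q ≡ p ⊎ q ≡ suc p ⊎ p ≡ suc q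
pair-meet P p q nonempty with 1≤∣p∣⇒some (pair P p ∩ pair P q) nonempty
... | u , u∈ with x∈p∩q⁻ (pair P p) (pair P q) (lookup⇒[]= u _ u∈)
... | u∈p , u∈q with pair-members P p u ([]=⇒lookup u∈p) | pair-members P q u ([]=⇒lookup u∈q)
...   | inj₁ u≡p   | inj₁ u≡q   = inj₁ (trans (sym u≡q) u≡p)
...   | inj₁ u≡p   | inj₂ u≡q+1 = inj₂ (inj₂ (trans (sym u≡p) u≡q+1))
...   | inj₂ u≡p+1 | inj₁ u≡q   = inj₂ (inj₁ (trans (sym u≡q) u≡p+1))
...   | inj₂ u≡p+1 | inj₂ u≡q+1 = inj₁ (suc-injective (trans (sym u≡q+1) u≡p+1))

∣pair∩pair-suc∣≡1 : ∀ {P p} → 3 + p ≤ P → ∣ pair P p ∩ pair P (suc p) ∣ ≡ 1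
∣pair∩pair-suc∣≡1 {suc (suc zero)}    {zero}  (s≤s (s≤s ()))
∣pair∩pair-suc∣≡1 {suc (suc (suc P))} {zero}  _          =
  cong suc (trans (cong ∣_∣ (∩-zeroˡ {suc P} (true ∷ ⊥))) (∣⊥∣≡0 (suc P)))
∣pair∩pair-suc∣≡1 {suc P}             {suc p} (s≤s fits) = ∣pair∩pair-suc∣≡1 fits

∣pair-suc∩pair∣≡1 : ∀ {P p} → 3 + p ≤ P → ∣ pair P (suc p) ∩ pair P p ∣ ≡ 1
∣pair-suc∩pair∣≡1 {P} {p} fits =
  trans (cong ∣_∣ (∩-comm (pair P (suc p)) (pair P p))) (∣pair∩pair-suc∣≡1 fits)

pair⊆pair⇒≡ : ∀ {P p q} → 2 + p ≤ P →
              (∀ u → lookup (pair P p) u ≡ true → lookup (pair P q) u ≡ true) → p ≡ q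
pair⊆pair⇒≡ {P} {p} {q} fits pair⊆pair
  with pair-∋-first fits | pair-∋-second fits
... | u , u≡p , u∈ | v , v≡1+p , v∈
  with pair-members P q u (pair⊆pair u u∈) | pair-members P q v (pair⊆pair v v∈)
... | inj₁ u≡q   | _          = trans (sym u≡p) u≡q
... | inj₂ _     | inj₂ v≡1+q = suc-injective (trans (sym v≡1+p) v≡1+q)
... | inj₂ u≡1+q | inj₁ v≡q   =
  ⊥-elim (m≢1+n+m q (trans (sym v≡q) (trans v≡1+p (cong suc (trans (sym u≡p) u≡1+q)))))

data Zone : Set where
  atSource atTarget free : Zone

zone : ℕ → Zone
zone 0 = atSource
zone 1 = free
zone 2 = free
zone 3 = atTarget
zone 4 = free
zone 5 = free
zone (suc (suc (suc (suc (suc (suc p)))))) = zone p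

zone-periodic : ∀ j r → zone (r + j * 6) ≡ zone r
zone-periodic j r = trans (cong zone (+-comm r (j * 6))) (shift j)
  where
  shift : ∀ j → zone (j * 6 + r) ≡ zone r
  shift zero    = refl
  shift (suc j) = shift j

-- While the top pair sits at 6j+1 the lower gadget can travel from source to target, and
-- at 6j+4 back again; climb L p a is the progress made when the top is at p and the
-- lower gadget has potential a.
climb : (L p a : ℕ) → ℕ
climb L 0 a = 0
climb L 1 a = a
climb L 2 a = L
climb L 3 a = L
climb L 4 a = L + (L ∸ a)
climb L 5 a = L + L
climb L (suc (suc (suc (suc (suc (suc p)))))) a = (L + L) + climb L p a

climb-periodic : ∀ L j a → climb L (j * 6) a ≡ j * (L + L)
climb-periodic L zero    a = refl
climb-periodic L (suc j) a = cong ((L + L) +_) (climb-periodic L j a)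

∸-lipschitz : ∀ L {a a′} → a ≤ suc a′ → L ∸ a′ ≤ suc (L ∸ a)
∸-lipschitz L {a} {a′} a≤1+a′ = m≤n+o⇒m∸n≤o L a′ (begin
  L                   ≤⟨ m≤n+m∸n L a ⟩
  a + (L ∸ a)         ≤⟨ +-monoˡ-≤ (L ∸ a) a≤1+a′ ⟩
  suc a′ + (L ∸ a)    ≡⟨ sym (+-suc a′ (L ∸ a)) ⟩
  a′ + suc (L ∸ a)    ∎)
  where open ≤-Reasoning

climb-lipschitz : ∀ L p {a a′} → a′ ≤ suc a → a ≤ suc a′ → climb L p a′ ≤ suc (climb L p a)
climb-lipschitz L 0 _      _      = z≤n
climb-lipschitz L 1 a′≤1+a _      = a′≤1+a
climb-lipschitz L 2 _      _      = n≤1+n L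
climb-lipschitz L 3 _      _      = n≤1+n L
climb-lipschitz L 4 {a}    _      a≤1+a′ =
  ≤-trans (+-monoʳ-≤ L (∸-lipschitz L a≤1+a′)) (≤-reflexive (+-suc L (L ∸ a)))
climb-lipschitz L 5 _      _      = n≤1+n (L + L)
climb-lipschitz L (suc (suc (suc (suc (suc (suc p)))))) {a} a′≤1+a a≤1+a′ =
  ≤-trans (+-monoʳ-≤ (L + L) (climb-lipschitz L p a′≤1+a a≤1+a′))
          (≤-reflexive (+-suc (L + L) (climb L p a)))

climb-suc : ∀ L p a → (zone p ≡ atSource ⊎ zone (2 + p) ≡ atSource → a ≡ 0) →
                      (zone p ≡ atTarget ⊎ zone (2 + p) ≡ atTarget → a ≡ L) →
            climb L (suc p) a ≡ climb L p a
climb-suc L 0 a at-source _ = at-source (inj₁ refl)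
climb-suc L 1 a _ at-target = sym (at-target (inj₂ refl))
climb-suc L 2 a _ _         = refl
climb-suc L 3 a _ at-target = begin
  L + (L ∸ a) ≡⟨ cong (λ a → L + (L ∸ a)) (at-target (inj₁ refl)) ⟩
  L + (L ∸ L) ≡⟨ cong (L +_) (n∸n≡0 L) ⟩
  L + 0       ≡⟨ +-identityʳ L ⟩
  L           ∎
  where open ≡-Reasoning
climb-suc L 4 a at-source _ = cong (λ a → L + (L ∸ a)) (sym (at-source (inj₂ refl)))
climb-suc L 5 a _ _         = +-identityʳ (L + L)
climb-suc L (suc (suc (suc (suc (suc (suc p)))))) a at-source at-target =
  cong ((L + L) +_) (climb-suc L p a at-source at-target)

-- Top vertex q is joined to the pins of its zone, so an independent set containing q meets
-- the gadget in a k-set of potential 0 (zone atSource) or L (zone atTarget).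
module Extension {k V L : ℕ} (P J : ℕ) (room : 2 + J * 6 ≤ P) (g : Gadget k V L) where
  open Gadget g

  pinnedBy : Zone → Fin V → Bool
  pinnedBy atSource = pinSource
  pinnedBy atTarget = pinTarget
  pinnedBy free     = λ _ → false

  Edge : Fin P ⊎ Fin V → Fin P ⊎ Fin V → Bool
  Edge (inj₁ u) (inj₁ v)  = apart (toℕ u) (toℕ v)
  Edge (inj₁ u) (inj₂ w)  = pinnedBy (zone (toℕ u)) w
  Edge (inj₂ w) (inj₁ u)  = pinnedBy (zone (toℕ u)) w
  Edge (inj₂ w) (inj₂ w′) = E graph w w′

  extended : Graph (P + V)
  extended = record
    { E      = λ x y → Edge (splitAt P x) (splitAt P y)
    ; sym    = λ x y → Edge-sym (splitAt P x) (splitAt P y)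
    ; irrefl = λ x → Edge-irrefl (splitAt P x) }
    where
    Edge-sym : ∀ x y → Edge x y ≡ Edge y x
    Edge-sym (inj₁ u) (inj₁ v)  = apart-sym (toℕ u) (toℕ v)
    Edge-sym (inj₁ u) (inj₂ w)  = refl
    Edge-sym (inj₂ w) (inj₁ u)  = refl
    Edge-sym (inj₂ w) (inj₂ w′) = Graph.sym graph w w′
    Edge-irrefl : ∀ x → Edge x x ≡ false
    Edge-irrefl (inj₁ u) = apart-irrefl (toℕ u)
    Edge-irrefl (inj₂ w) = irrefl graph w

  Allowed : ℕ → Subset V → Set
  Allowed q b = Avoids b (pinnedBy (zone q))

  Compatible : Subset P → Subset V → Set
  Compatible a b = ∀ u → lookup a u ≡ true → Allowed (toℕ u) b

  Independent-++⁻ : ∀ a b → Independent extended (a ++ b) →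
                    Close a × Independent graph b × Compatible a b
  Independent-++⁻ a b ind =
    (λ u v u∈ v∈ → trans (sym (cong₂ Edge (splitAt-↑ˡ P u V) (splitAt-↑ˡ P v V)))
                         (ind _ _ (in-top u∈) (in-top v∈))) ,
    (λ w w′ w∈ w′∈ → trans (sym (cong₂ Edge (splitAt-↑ʳ P V w) (splitAt-↑ʳ P V w′)))
                           (ind _ _ (in-bottom w∈) (in-bottom w′∈))) ,
    (λ u u∈ w w∈ → trans (sym (cong₂ Edge (splitAt-↑ˡ P u V) (splitAt-↑ʳ P V w)))
                         (ind _ _ (in-top u∈) (in-bottom w∈)))
    where
    in-top : ∀ {u} → lookup a u ≡ true → lookup (a ++ b) (u ↑ˡ V) ≡ true
    in-top {u} = trans (lookup-++ˡ a b u)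
    in-bottom : ∀ {w} → lookup b w ≡ true → lookup (a ++ b) (P ↑ʳ w) ≡ true
    in-bottom {w} = trans (lookup-++ʳ a b w)

  Independent-++⁺ : ∀ a b → Close a → Independent graph b → Compatible a b →
                    Independent extended (a ++ b)
  Independent-++⁺ a b close ind compatible x y x∈ y∈ =
    independent (splitAt P x) (splitAt P y)
      (trans (sym (lookup-splitAt P a b x)) x∈) (trans (sym (lookup-splitAt P a b y)) y∈)
    where
    independent : ∀ x y → [ lookup a , lookup b ]′ x ≡ true → [ lookup a , lookup b ]′ y ≡ true →
                  Edge x y ≡ false
    independent (inj₁ u) (inj₁ v)  u∈ v∈  = close u v u∈ v∈
    independent (inj₁ u) (inj₂ w)  u∈ w∈  = compatible u u∈ w w∈
    independent (inj₂ w) (inj₁ u)  w∈ u∈  = compatible u u∈ w w∈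
    independent (inj₂ w) (inj₂ w′) w∈ w′∈ = ind w w′ w∈ w′∈

  record Placement (p : ℕ) (b : Subset V) : Set where
    field
      fits           : 2 + p ≤ P
      bottom-ind     : IndSet graph k b
      allowed-first  : Allowed p b
      allowed-second : Allowed (suc p) b

  data Shape : Subset (P + V) → Set where
    shape : ∀ {p b} → Placement p b → Shape (pair P p ++ b)

  Placement⇒IndSet : ∀ {p b} → Placement p b → IndSet extended (2 + k) (pair P p ++ b)
  Placement⇒IndSet {p} {b} pl = Independent⇒IndSet {G = extended}
    (trans (∣p++q∣≡∣p∣+∣q∣ (pair P p) b) (cong₂ _+_ (∣pair∣≡2 fits) (proj₁ bottom-ind)))
    (Independent-++⁺ (pair P p) b (pair-Close P p) (IndSet⇒Independent {G = graph} bottom-ind) compatible)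
    where
    open Placement pl
    compatible : Compatible (pair P p) b
    compatible u u∈ with pair-members P p u u∈
    ... | inj₁ u≡p   rewrite u≡p   = allowed-first
    ... | inj₂ u≡p+1 rewrite u≡p+1 = allowed-second

  IndSet-++⇒Placement : ∀ a b → IndSet extended (2 + k) (a ++ b) →
                        a ≡ pair P (firstIndex a) × Placement (firstIndex a) b
  IndSet-++⇒Placement a b a++b-ind =
    let close , b-ind , compatible = Independent-++⁻ a b (IndSet⇒Independent {G = extended} a++b-ind)
        ∣a∣≡2 , ∣b∣≡k = ≤∧≤∧+≡⇒≡ (Close⇒∣a∣≤2 a close) (independence≤ b b-ind)
                                 (trans (sym (∣p++q∣≡∣p∣+∣q∣ a b)) (proj₁ a++b-ind))
        a≡pair , fits = Close∧∣a∣≡2⇒pair a close ∣a∣≡2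
        allowed : ∀ {q} → (∃ λ u → toℕ u ≡ q × lookup (pair P (firstIndex a)) u ≡ true) →
                  Allowed q b
        allowed = λ (u , u≡q , u∈) →
          subst (λ q → Allowed q b) u≡q (compatible u (trans (cong (λ a → lookup a u) a≡pair) u∈))
    in a≡pair , record { fits = fits ; bottom-ind = Independent⇒IndSet {G = graph} ∣b∣≡k b-ind
                       ; allowed-first = allowed (pair-∋-first fits)
                       ; allowed-second = allowed (pair-∋-second fits) }

  IndSet⇒Shape : ∀ s → IndSet extended (2 + k) s → Shape s
  IndSet⇒Shape s s-ind = subst Shape (take++drop≡id P s) shape-take++drop
    where
    a = take P s
    b = drop P s
    placement = IndSet-++⇒Placement a b (subst (IndSet extended (2 + k)) (sym (take++drop≡id P s)) s-ind)
    shape-take++drop : Shape (a ++ b)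
    shape-take++drop = subst (λ a → Shape (a ++ b)) (sym (proj₁ placement)) (shape (proj₂ placement))

  height : ℕ → Subset V → ℕ
  height p b = p + climb L p (potential b)

  potential⁺ : Subset (P + V) → ℕ
  potential⁺ s = height (firstIndex (take P s)) (drop P s)

  potential⁺-pair++ : ∀ {p} b → 2 + p ≤ P → potential⁺ (pair P p ++ b) ≡ height p b
  potential⁺-pair++ {p} b fits =
    cong₂ height (trans (cong firstIndex (take-++ (pair P p) b)) (firstIndex-pair fits)) (drop-++ (pair P p) b)

  Allowed⇒potential≡0 : ∀ q {b} → IndSet graph k b → Allowed q b → zone q ≡ atSource →
                        potential b ≡ 0
  Allowed⇒potential≡0 q {b} b-ind allowed source-zone =
    pinned-source b b-ind (subst (λ z → Avoids b (pinnedBy z)) source-zone allowed)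

  Allowed⇒potential≡L : ∀ q {b} → IndSet graph k b → Allowed q b → zone q ≡ atTarget →
                        potential b ≡ L
  Allowed⇒potential≡L q {b} b-ind allowed target-zone =
    pinned-target b b-ind (subst (λ z → Avoids b (pinnedBy z)) target-zone allowed)

  height-suc : ∀ {p b} → Placement p b → Allowed (2 + p) b → height (suc p) b ≡ suc (height p b)
  height-suc {p} {b} pl allowed-third = cong (suc p +_) (climb-suc L p (potential b)
    [ Allowed⇒potential≡0 p bottom-ind allowed-first
    , Allowed⇒potential≡0 (2 + p) bottom-ind allowed-third ]′
    [ Allowed⇒potential≡L p bottom-ind allowed-first
    , Allowed⇒potential≡L (2 + p) bottom-ind allowed-third ]′)
    where open Placement pl

  one-shared⇒same-bottom : ∀ {b b′} → IndSet graph k b → IndSet graph k b′ →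
                           1 + ∣ b ∩ b′ ∣ ≡ suc k → b ≡ b′
  one-shared⇒same-bottom {b} {b′} (∣b∣≡k , _) (∣b′∣≡k , _) shared =
    ∣p∩q∣≡∣p∣≡∣q∣⇒p≡q b b′ (trans (suc-injective shared) (sym ∣b∣≡k))
                           (trans ∣b∣≡k (sym ∣b′∣≡k))

  height-stay : ∀ {p b b′} → Placement p b → Placement p b′ →
                ∣ pair P p ∩ pair P p ∣ + ∣ b ∩ b′ ∣ ≡ suc k → height p b′ ≤ suc (height p b)
  height-stay {p} {b} {b′} pl pl′ shared =
    ≤-trans (+-monoʳ-≤ p (climb-lipschitz L p (potential-lipschitz b b′ adj)
                                               (potential-lipschitz b′ b (RAdj-sym graph k adj))))
            (≤-reflexive (+-suc p _))
    where
    open Placement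
    k≡1+shared : k ≡ suc ∣ b ∩ b′ ∣
    k≡1+shared = suc-injective (sym (trans (cong (_+ ∣ b ∩ b′ ∣) (sym (∣pair∩pair∣≡2 (fits pl)))) shared))
    adj : RAdj graph k b b′
    adj = bottom-ind pl , bottom-ind pl′ , sym (cong (_∸ 1) k≡1+shared)

  height-lipschitz : ∀ {p p′ b b′} → Placement p b → Placement p′ b′ →
                     ∣ pair P p ∩ pair P p′ ∣ + ∣ b ∩ b′ ∣ ≡ suc k → height p′ b′ ≤ suc (height p b)
  -- Overlapping pairs are equal or shifted by one; a shifted pair shares only one top token,
  -- so the lower sets share all k of theirs and coincide.
  height-lipschitz {p} {p′} {b} {b′} pl pl′ shared
    with pair-meet P p p′ (m+n≡1+o∧n≤o⇒1≤m shared
                             (≤-trans (∣p∩q∣≤∣p∣ b b′) (≤-reflexive (proj₁ (Placement.bottom-ind pl)))))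
  ... | inj₁ refl = height-stay pl pl′ shared
  ... | inj₂ (inj₁ refl)
    with refl ← one-shared⇒same-bottom (Placement.bottom-ind pl) (Placement.bottom-ind pl′)
                  (trans (cong (_+ ∣ b ∩ b′ ∣) (sym (∣pair∩pair-suc∣≡1 (Placement.fits pl′)))) shared)
    = ≤-reflexive (height-suc pl (Placement.allowed-second pl′))
  ... | inj₂ (inj₂ refl)
    with refl ← one-shared⇒same-bottom (Placement.bottom-ind pl) (Placement.bottom-ind pl′)
                  (trans (cong (_+ ∣ b ∩ b′ ∣) (sym (∣pair-suc∩pair∣≡1 (Placement.fits pl)))) shared)
    = ≤-trans (n≤1+n _)
        (≤-trans (n≤1+n _) (≤-reflexive (cong suc (sym (height-suc pl′ (Placement.allowed-second pl))))))

  potential⁺-lipschitz : ∀ I J → RAdj extended (2 + k) I J → potential⁺ J ≤ suc (potential⁺ I)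
  potential⁺-lipschitz I J (I-ind , J-ind , shared) with IndSet⇒Shape I I-ind | IndSet⇒Shape J J-ind
  ... | shape {p} {b} pl | shape {p′} {b′} pl′ =
    subst₂ (λ x y → x ≤ suc y) (sym (potential⁺-pair++ b′ (Placement.fits pl′)))
                               (sym (potential⁺-pair++ b (Placement.fits pl)))
      (height-lipschitz pl pl′ (trans (sym (∣p++q∩r++s∣ (pair P p) (pair P p′) b b′)) shared))

  advance : ∀ {p b} → 3 + p ≤ P → IndSet graph k b → Allowed p b → Allowed (1 + p) b → Allowed (2 + p) b →
            RAdj extended (2 + k) (pair P p ++ b) (pair P (suc p) ++ b)
  advance {p} {b} fits b-ind allowed₀ allowed₁ allowed₂ =
    Placement⇒IndSet (record { fits = ≤-trans (n≤1+n _) fits ; bottom-ind = b-ind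
                             ; allowed-first = allowed₀ ; allowed-second = allowed₁ }) ,
    Placement⇒IndSet (record { fits = fits ; bottom-ind = b-ind
                             ; allowed-first = allowed₁ ; allowed-second = allowed₂ }) ,
    trans (∣p++q∩r++s∣ (pair P p) (pair P (suc p)) b b)
          (cong₂ _+_ (∣pair∩pair-suc∣≡1 fits) (trans (cong ∣_∣ (∩-idem b)) (proj₁ b-ind)))

  free-allowed : ∀ q b → zone q ≡ free → Allowed q b
  free-allowed q b free-zone = subst (λ z → Avoids b (pinnedBy z)) (sym free-zone) (λ _ _ → refl)

  Walk-lift-1≤k : ∀ {p} → 2 + p ≤ P → zone p ≡ free → zone (suc p) ≡ free → 1 ≤ k → ∀ {b b′ m} →
                  Walk graph k b b′ m → Walk extended (2 + k) (pair P p ++ b) (pair P p ++ b′) m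
  Walk-lift-1≤k {p} fits free₀ free₁ 1≤k = lift
    where
    placed : ∀ {b} → IndSet graph k b → IndSet extended (2 + k) (pair P p ++ b)
    placed {b} b-ind = Placement⇒IndSet (record { fits = fits ; bottom-ind = b-ind
                                                ; allowed-first = free-allowed p b free₀
                                                ; allowed-second = free-allowed (suc p) b free₁ })
    lift : ∀ {b b′ m} → Walk graph k b b′ m → Walk extended (2 + k) (pair P p ++ b) (pair P p ++ b′) m
    lift (here b-ind) = here (placed b-ind)
    lift {b} (step {J = b′} (b-ind , b′-ind , shared) walk) =
      step (placed b-ind , placed b′-ind , trans (∣p++q∩r++s∣ (pair P p) (pair P p) b b′)
              (trans (cong₂ _+_ (∣pair∩pair∣≡2 fits) shared)
                     (cong suc (m+[n∸m]≡n 1≤k))))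
           (lift walk)

  Walk-lift : ∀ {p} → 2 + p ≤ P → zone p ≡ free → zone (suc p) ≡ free → ∀ {b b′ m} →
               Walk graph k b b′ m → ∃ λ m′ → Walk extended (2 + k) (pair P p ++ b) (pair P p ++ b′) m′
  -- For k = 0 a lifted step would share both top tokens, but then the lower walk is constant.
  Walk-lift {p} fits free₀ free₁ {b} {b′} walk with 1 ≤? k
  ... | yes 1≤k = _ , Walk-lift-1≤k fits free₀ free₁ 1≤k walk
  ... | no  1≰k = 0 , subst (λ b′ → Walk extended (2 + k) _ (pair P _ ++ b′) 0) b≡b′
                             (here (Placement⇒IndSet (record { fits = fits ; bottom-ind = Walk-source walk
                                                             ; allowed-first = free-allowed p b free₀
                                                             ; allowed-second = free-allowed (suc p) b free₁ })))
    where
    empty : ∀ {b} → IndSet graph k b → ∣ b ∣ ≡ 0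
    empty (∣b∣≡k , _) = trans ∣b∣≡k (n<1⇒n≡0 (≰⇒> 1≰k))
    b≡b′ : b ≡ b′
    b≡b′ = ∣p∩q∣≡∣p∣≡∣q∣⇒p≡q b b′
             (trans (n≤0⇒n≡0 (≤-trans (∣p∩q∣≤∣p∣ b b′) (≤-reflexive (empty (Walk-source walk)))))
                    (sym (empty (Walk-source walk))))
             (trans (empty (Walk-source walk)) (sym (empty (Walk-target walk))))

  source-allowed : ∀ q → zone q ≢ atTarget → Allowed q source
  source-allowed q not-target with zone q
  ... | atSource = source-avoids
  ... | atTarget = ⊥-elim (not-target refl)
  ... | free     = λ _ _ → refl

  target-allowed : ∀ q → zone q ≢ atSource → Allowed q target
  target-allowed q not-source with zone q
  ... | atSource = ⊥-elim (not-source refl)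
  ... | atTarget = target-avoids
  ... | free     = λ _ _ → refl

  source-at : ∀ j r → zone r ≢ atTarget → Allowed (r + j * 6) source
  source-at j r ≢target = source-allowed (r + j * 6) (≢target ∘ trans (sym (zone-periodic j r)))

  target-at : ∀ j r → zone r ≢ atSource → Allowed (r + j * 6) target
  target-at j r ≢source = target-allowed (r + j * 6) (≢source ∘ trans (sym (zone-periodic j r)))

  source-placement : ∀ j → 2 + j * 6 ≤ P → Placement (j * 6) source
  source-placement j fits = record
    { fits = fits ; bottom-ind = source-ind
    ; allowed-first = source-at j 0 (λ ()) ; allowed-second = source-at j 1 (λ ()) }

  round : ∀ j → 8 + j * 6 ≤ P →
            ∃ λ m → Walk extended (2 + k) (pair P (j * 6) ++ source) (pair P (suc j * 6) ++ source) m
  round j fits = _ ,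
    step (advance-source 0 (λ ()) (λ ()) (λ ()))
    (Walk-++ (proj₂ (lift-at 1 refl refl (proj₂ source⇝target)))
    (step (advance-target 1 (λ ()) (λ ()) (λ ()))
    (step (advance-target 2 (λ ()) (λ ()) (λ ()))
    (step (advance-target 3 (λ ()) (λ ()) (λ ()))
    (Walk-++ (proj₂ (lift-at 4 refl refl (Walk-reverse (proj₂ source⇝target))))
    (step (advance-source 4 (λ ()) (λ ()) (λ ()))
    (step (advance-source 5 (λ ()) (λ ()) (λ ()))
    (here (Placement⇒IndSet (source-placement (suc j) fits))))))))))
    where
    fits-at : ∀ r → {True (3 + r ≤? 8)} → 3 + (r + j * 6) ≤ P
    fits-at r {3+r≤8} = ≤-trans (+-monoˡ-≤ (j * 6) (toWitness 3+r≤8)) fits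
    advance-source : ∀ r → {True (3 + r ≤? 8)} →
      zone r ≢ atTarget → zone (1 + r) ≢ atTarget → zone (2 + r) ≢ atTarget →
      RAdj extended (2 + k) (pair P (r + j * 6) ++ source) (pair P (suc r + j * 6) ++ source)
    advance-source r {h} z₀ z₁ z₂ = advance (fits-at r {h}) source-ind
      (source-at j r z₀) (source-at j (1 + r) z₁) (source-at j (2 + r) z₂)
    advance-target : ∀ r → {True (3 + r ≤? 8)} →
      zone r ≢ atSource → zone (1 + r) ≢ atSource → zone (2 + r) ≢ atSource →
      RAdj extended (2 + k) (pair P (r + j * 6) ++ target) (pair P (suc r + j * 6) ++ target)
    advance-target r {h} z₀ z₁ z₂ = advance (fits-at r {h}) target-ind
      (target-at j r z₀) (target-at j (1 + r) z₁) (target-at j (2 + r) z₂)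
    lift-at : ∀ r → {True (3 + r ≤? 8)} → zone r ≡ free → zone (1 + r) ≡ free → ∀ {b b′ m} →
              Walk graph k b b′ m →
              ∃ λ m′ → Walk extended (2 + k) (pair P (r + j * 6) ++ b) (pair P (r + j * 6) ++ b′) m′
    lift-at r {h} free₀ free₁ = Walk-lift (≤-trans (n≤1+n _) (fits-at r {h}))
      (trans (zone-periodic j r) free₀) (trans (zone-periodic j (1 + r)) free₁)

  rounds : ∀ j → 2 + j * 6 ≤ P →
           ∃ λ m → Walk extended (2 + k) (pair P 0 ++ source) (pair P (j * 6) ++ source) m
  rounds zero    fits = 0 , here (Placement⇒IndSet (source-placement 0 fits))
  rounds (suc j) fits =
    _ , Walk-++ (proj₂ (rounds j (≤-trans (m≤n+m (2 + j * 6) 6) fits))) (proj₂ (round j fits))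

  outside : Subset P → Fin (P + V) → Bool
  outside a x = [ (λ u → not (lookup a u)) , (λ _ → false) ]′ (splitAt P x)

  pair++-avoids-outside : ∀ q b → Avoids (pair P q ++ b) (outside (pair P q))
  pair++-avoids-outside q b x x∈ =
    avoids (splitAt P x) (trans (sym (lookup-splitAt P (pair P q) b x)) x∈)
    where
    avoids : ∀ y → [ lookup (pair P q) , lookup b ]′ y ≡ true →
             [ (λ u → not (lookup (pair P q) u)) , (λ _ → false) ]′ y ≡ false
    avoids (inj₁ u) u∈ = cong not u∈
    avoids (inj₂ w) _  = refl

  pinned-at : ∀ q s → IndSet extended (2 + k) s → Avoids s (outside (pair P q)) →
              potential⁺ s ≡ height q (drop P s)
  pinned-at q s s-ind avoids with IndSet⇒Shape s s-ind
  ... | shape {p} {b} pl = begin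
    potential⁺ (pair P p ++ b)     ≡⟨ potential⁺-pair++ b (Placement.fits pl) ⟩
    height p b                     ≡⟨ cong₂ height (pair⊆pair⇒≡ (Placement.fits pl) pair⊆pair)
                                                   (sym (drop-++ (pair P p) b)) ⟩
    height q (drop P (pair P p ++ b)) ∎
    where
    open ≡-Reasoning
    not-true : ∀ {x} → not x ≡ false → x ≡ true
    not-true {true} _ = refl
    pair⊆pair : ∀ u → lookup (pair P p) u ≡ true → lookup (pair P q) u ≡ true
    pair⊆pair u u∈ = not-true (trans (cong [ (λ u → not (lookup (pair P q) u)) , (λ _ → false) ]′ (sym (splitAt-↑ˡ P u V)))
                                     (avoids (u ↑ˡ V) (trans (lookup-++ˡ (pair P p) b u) u∈)))

  independence⁺≤ : ∀ s → Independent extended s → ∣ s ∣ ≤ 2 + k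
  independence⁺≤ s ind = begin
    ∣ s ∣                        ≡⟨ cong ∣_∣ (sym (take++drop≡id P s)) ⟩
    ∣ take P s ++ drop P s ∣     ≡⟨ ∣p++q∣≡∣p∣+∣q∣ (take P s) (drop P s) ⟩
    ∣ take P s ∣ + ∣ drop P s ∣  ≤⟨ +-mono-≤ (Close⇒∣a∣≤2 (take P s) close)
                                             (independence≤ (drop P s) drop-ind) ⟩
    2 + k                        ∎
    where
    open ≤-Reasoning
    parts = Independent-++⁻ (take P s) (drop P s) (subst (Independent extended) (sym (take++drop≡id P s)) ind)
    close = proj₁ parts
    drop-ind = proj₁ (proj₂ parts)

  gadget : Gadget (2 + k) (P + V) (J * 6 + J * (L + L))
  gadget = record
    { graph = extended ; potential = potential⁺
    ; source = pair P 0 ++ source ; target = pair P (J * 6) ++ source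
    ; source-ind = Placement⇒IndSet (source-placement 0 2≤P)
    ; target-ind = Placement⇒IndSet (source-placement J room)
    ; source⇝target = rounds J room
    ; potential-lipschitz = potential⁺-lipschitz
    ; potential-source = potential⁺-pair++ source 2≤P
    ; potential-target = trans (potential⁺-pair++ source room) (cong (J * 6 +_) (climb-periodic L J _))
    ; pinSource = outside (pair P 0) ; pinTarget = outside (pair P (J * 6))
    ; pinned-source = λ s s-ind avoids → pinned-at 0 s s-ind avoids
    ; pinned-target = λ s s-ind avoids →
        trans (pinned-at (J * 6) s s-ind avoids) (cong (J * 6 +_) (climb-periodic L J _))
    ; source-avoids = pair++-avoids-outside 0 source
    ; target-avoids = pair++-avoids-outside (J * 6) source
    ; independence≤ = independence⁺≤ }
    where
    2≤P : 2 ≤ P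
    2≤P = ≤-trans (m≤m+n 2 (J * 6)) room

order : ℕ → ℕ → ℕ
order J 0             = 0
order J 1             = 2
order J (suc (suc k)) = (2 + J * 6) + order J k

length : ℕ → ℕ → ℕ
length J 0             = 0
length J 1             = 1
length J (suc (suc k)) = J * 6 + J * (length J k + length J k)

tower : ∀ J k → Gadget k (order J k) (length J k)
tower J 0             = emptyGadget
tower J 1             = CompleteGadget.gadget 0
tower J (suc (suc k)) = Extension.gadget (2 + J * 6) J ≤-refl (tower J k)

-- The top path absorbs all vertices beyond those of the tower below it.
D≥-tower : ∀ J k {n} → 2 + J * 6 + order J k ≤ n → D≥ n (2 + k) (length J (2 + k))
D≥-tower J k {n} fits =
  subst (λ V → D≥ V (2 + k) (length J (2 + k))) (m∸n+n≡m (m+n≤o⇒n≤o (2 + J * 6) fits))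
  (Gadget⇒D≥ (Extension.gadget (n ∸ order J k) J (m+n≤o⇒m≤o∸n (2 + J * 6) fits) (tower J k)))

order≤ : ∀ J k → order J k ≤ ⌊ k /2⌋ * (2 + J * 6) + 2
order≤ J 0             = z≤n
order≤ J 1             = ≤-refl
order≤ J (suc (suc k)) =
  ≤-trans (+-monoʳ-≤ (2 + J * 6) (order≤ J k))
          (≤-reflexive (sym (+-assoc (2 + J * 6) (⌊ k /2⌋ * (2 + J * 6)) 2)))

x≤3+L⇒2Jx≤J*6+J*[L+L] : ∀ J L {x} → x ≤ 3 + L → 2 * J * x ≤ J * 6 + J * (L + L)
x≤3+L⇒2Jx≤J*6+J*[L+L] J L x≤3+L = ≤-trans (*-monoʳ-≤ (2 * J) x≤3+L) (≤-reflexive (identity J L))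
  where
  identity : ∀ J L → 2 * J * (3 + L) ≡ J * 6 + J * (L + L)
  identity = solve-∀

length-grows : ∀ J k → (2 * J) ^ suc ⌊ k /2⌋ ≤ length J (2 + k)
length-grows J 0             = x≤3+L⇒2Jx≤J*6+J*[L+L] J 0 (s≤s z≤n)
length-grows J 1             = x≤3+L⇒2Jx≤J*6+J*[L+L] J 1 (s≤s z≤n)
length-grows J (suc (suc k)) =
  x≤3+L⇒2Jx≤J*6+J*[L+L] J (length J (2 + k)) (≤-trans (length-grows J k) (m≤n+m _ 3))

scale : ℕ → ℕ
scale k = 16 + 8 * ⌊ k /2⌋

tower-fits : ∀ J k {n} → 1 ≤ J → J * scale k ≤ n → 2 + J * 6 + order J k ≤ n
tower-fits (suc j) k {n} _ J*scale≤n = begin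
  2 + J * 6 + order J k              ≤⟨ +-monoʳ-≤ (2 + J * 6) (order≤ J k) ⟩
  2 + J * 6 + (T * (2 + J * 6) + 2)  ≤⟨ m≤m+n _ (6 + 10 * j + 2 * T * j) ⟩
  _                                  ≡⟨ slack T j ⟩
  J * scale k                        ≤⟨ J*scale≤n ⟩
  n                                  ∎
  where
  open ≤-Reasoning
  J = suc j
  T = ⌊ k /2⌋
  slack : ∀ T j → 2 + suc j * 6 + (T * (2 + suc j * 6) + 2) + (6 + 10 * j + 2 * T * j) ≡ suc j * (16 + 8 * T)
  slack = solve-∀

length-dominates : ∀ J k {n} → n ≤ scale k * (2 * J) →
                   n ^ suc ⌊ k /2⌋ ≤ scale k ^ suc ⌊ k /2⌋ * length J (2 + k)
length-dominates J k {n} n≤2J*scale = begin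
  n ^ t                         ≤⟨ ^-monoˡ-≤ t n≤2J*scale ⟩
  (scale k * (2 * J)) ^ t       ≡⟨ [m*n]^o≡m^o*n^o (scale k) (2 * J) t ⟩
  scale k ^ t * (2 * J) ^ t     ≤⟨ *-monoʳ-≤ (scale k ^ t) (length-grows J k) ⟩
  scale k ^ t * length J (2 + k) ∎
  where
  open ≤-Reasoning
  t = suc ⌊ k /2⌋

mainTheorem9 : (k : ℕ) → 1 ≤ k →
    Σ ℕ λ c → (1 ≤ c) × (Σ ℕ λ N → (n : ℕ) → N ≤ n →
      Σ ℕ λ d → (n ^ ⌊ k /2⌋ ≤ c * d) × D≥ n k d)
mainTheorem9 (suc zero) _ = 1 , ≤-refl , 2 , λ where
  (suc (suc b)) _ → 1 , ≤-refl , Gadget⇒D≥ (CompleteGadget.gadget b)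
  (suc zero) (s≤s ())
mainTheorem9 (suc (suc k)) _ =
  scale k ^ suc ⌊ k /2⌋ , m^n>0 (scale k) (suc ⌊ k /2⌋) , scale k , λ n scale≤n →
  let J = n / scale k
      1≤J , J*scale≤n , n≤2J*scale = quotient-bounds (scale k) scale≤n
  in length J (2 + k) , length-dominates J k n≤2J*scale , D≥-tower J k (tower-fits J k 1≤J J*scale≤n)
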